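{- Let $T$ be the complement of a bipartite trigraph or the complement of a line trigraph. Then every path of odd length in $T$ has length at most three.
   Context: A trigraph $T$ consists of a finite set $V(T)$ and a map $\theta:\binom{V(T)}{2}\to\{ -1,0,1\}$; distinct $u,v$ are strongly adjacent if $\theta(uv)=1$, strongly antiadjacent if $\theta(uv)=-1$, adjacent if $\theta(uv)\in\{0,1\}$, antiadjacent if $\theta(uv)\in\{0,-1\}$. The complement $\overline T$ has adjacency function $-\theta$. The full realization is the graph whose edges are the adjacent pairs. A clique (strong clique) is a set of pairwise adjacent (strongly adjacent) vertices; a strongly stable set is a set of pairwise strongly antiadjacent vertices. $T$ is bipartite if $V(T)$ can be partitioned into two strongly stable sets; $T$ is a line trigraph if its full realization is the line graph of a bipartite graph and every clique of size at least $3$ is a strong clique. A path is a sequence $p_1,\dots,p_k$ of distinct vertices with $p_i,p_j$ adjacent when $|i-j|=1$ and antiadjacent when $|i-j|>1$; its length is $k-1$. -}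

module Defs where

open import Data.Nat using (ℕ; suc; _+_; _*_; _≤_)
open import Data.Fin using (Fin; toℕ)
open import Data.Fin.Subset using (Subset; _∈_; ∣_∣)
open import Data.Bool using (Bool)
open import Data.Product using (Σ; _×_; _,_; proj₁; proj₂; ∃)
open import Data.Sum using (_⊎_)
open import Relation.Binary.PropositionalEquality using (_≡_; _≢_)
open import Relation.Nullary using (¬_)
open import Function.Bundles using (_⇔_)

data Val : Set where
  neg zer pos : Val

negV : Val → Val
negV neg = pos
negV zer = zer
negV pos = neg

-- A trigraph on vertex set Fin n.  θ is given as a symmetric function on
-- ordered pairs; its values on the diagonal are irrelevant (never used).
record Trigraph (n : ℕ) : Set where
  field
    θ   : Fin n → Fin n → Val
    sym : ∀ u v → θ u v ≡ θ v u
open Trigraph public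

complement : ∀ {n} → Trigraph n → Trigraph n
complement T = record { θ = λ u v → negV (θ T u v) ; sym = λ u v → symV (sym T u v) }
  where
  symV : ∀ {a b} → a ≡ b → negV a ≡ negV b
  symV Relation.Binary.PropositionalEquality.refl = Relation.Binary.PropositionalEquality.refl

StronglyAdjacent : ∀ {n} → Trigraph n → Fin n → Fin n → Set
StronglyAdjacent T u v = θ T u v ≡ pos

StronglyAntiadjacent : ∀ {n} → Trigraph n → Fin n → Fin n → Set
StronglyAntiadjacent T u v = θ T u v ≡ neg

Adjacent : ∀ {n} → Trigraph n → Fin n → Fin n → Set
Adjacent T u v = (θ T u v ≡ zer) ⊎ (θ T u v ≡ pos)

Antiadjacent : ∀ {n} → Trigraph n → Fin n → Fin n → Set
Antiadjacent T u v = (θ T u v ≡ zer) ⊎ (θ T u v ≡ neg)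

IsClique : ∀ {n} → Trigraph n → Subset n → Set
IsClique T S = ∀ u v → u ∈ S → v ∈ S → u ≢ v → Adjacent T u v

IsStrongClique : ∀ {n} → Trigraph n → Subset n → Set
IsStrongClique T S = ∀ u v → u ∈ S → v ∈ S → u ≢ v → StronglyAdjacent T u v

IsStronglyStable : ∀ {n} → Trigraph n → Subset n → Set
IsStronglyStable T S = ∀ u v → u ∈ S → v ∈ S → u ≢ v → StronglyAntiadjacent T u v

IsBipartite : ∀ {n} → Trigraph n → Set
IsBipartite {n} T =
  Σ (Fin n → Bool) λ side →
    ∀ u v → u ≢ v → side u ≡ side v → StronglyAntiadjacent T u v

-- The full realization of T (graph on Fin n with edges = adjacent pairs) is
-- the line graph of a bipartite graph H.  H has bipartition X = Fin p,
-- Y = Fin q; its edge set is in bijection with V(T) via an injective map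
-- e : Fin n → Fin p × Fin q (every edge of H joins X to Y), and two distinct
-- vertices of T are adjacent iff the corresponding edges share an endpoint.
FullRealizationIsLineGraphOfBipartite : ∀ {n} → Trigraph n → Set
FullRealizationIsLineGraphOfBipartite {n} T =
  Σ ℕ λ p → Σ ℕ λ q → Σ (Fin n → Fin p × Fin q) λ e →
    (∀ u v → e u ≡ e v → u ≡ v) ×
    (∀ u v → u ≢ v →
       Adjacent T u v ⇔ ((proj₁ (e u) ≡ proj₁ (e v)) ⊎ (proj₂ (e u) ≡ proj₂ (e v))))

IsLineTrigraph : ∀ {n} → Trigraph n → Set
IsLineTrigraph {n} T =
  FullRealizationIsLineGraphOfBipartite T ×
  (∀ (S : Subset n) → IsClique T S → 3 ≤ ∣ S ∣ → IsStrongClique T S)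

-- A path p_0, …, p_k (k+1 distinct vertices); its length is k.
record Path {n : ℕ} (T : Trigraph n) (k : ℕ) : Set where
  field
    vert     : Fin (suc k) → Fin n
    distinct : ∀ i j → vert i ≡ vert j → i ≡ j
    adj      : ∀ i j → toℕ j ≡ suc (toℕ i) → Adjacent T (vert i) (vert j)
    antiadj  : ∀ i j → 2 + toℕ i ≤ toℕ j → Antiadjacent T (vert i) (vert j)

OddNat : ℕ → Set
OddNat k = ∃ λ m → k ≡ suc (2 * m)

{-# OPTIONS --safe #-}
-- A path of length 5 contains one of length 4, and an odd length above 3 is at least 5; so it suffices
-- to exclude paths p₀ … p₄ in the complement of a bipartite trigraph T, and paths p₀ … p₅ in the
-- complement of a line trigraph T.  In the first case p₀, p₂, p₄ are pairwise adjacent in T, yet two of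
-- them lie on the same side, where they are strongly antiadjacent.  In the second case every triangle of
-- T is strong, so p₀p₁, p₃p₄ and p₄p₅, each with a common T-neighbour on the path, are not edges of T:
-- as edges e(pᵢ) of the root graph H they are disjoint.  Each of p₃, p₄, p₅ is T-adjacent to p₀ and p₁,
-- so it joins an end of e(p₀) to an end of e(p₁); there are only two such edges of H and consecutive
-- ones differ, hence e(p₃) = e(p₅), contradicting injectivity of e.
module Submission where

open import Defs
open import Data.Bool using (Bool; true; false)
open import Data.Empty using (⊥-elim)
open import Data.Fin using (Fin; toℕ; inject≤; #_)
open import Data.Fin.Properties using (toℕ-inject≤; inject≤-injective)
open import Data.Fin.Subset using (Subset; ⁅_⁆; _∪_; ∣_∣; _∉_) renaming (_∈_ to _∈ₛ_)
open import Data.Fin.Subset.Properties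
  using (x∈⁅x⁆; x∈⁅y⁆⇒x≡y; x≢y⇒x∉⁅y⁆; ∣⁅x⁆∣≡1; p⊂q⇒∣p∣<∣q∣; q⊆p∪q; x∈p∪q⁻; x∈p∪q⁺)
open import Data.Nat using (ℕ; zero; suc; _+_; _≤_; _<_; z≤n; s≤s; _≤?_)
open import Data.Nat.Properties using (≤-refl; ≤-trans; m≤n+m; m+n≤o⇒n≤o; 1+n≰n; 1+n≢n)
open import Data.Product using (_×_; _,_; proj₁; proj₂)
open import Data.Sum using (_⊎_; inj₁; inj₂; [_,_]′)
open import Function.Bundles using (Equivalence)
open import Relation.Binary.PropositionalEquality
  using (_≡_; _≢_; refl; trans; subst) renaming (sym to ≡-sym)
open import Relation.Nullary using (¬_)
open import Relation.Nullary.Decidable using (True; toWitness)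

module _ {n} (T : Trigraph n) {u v : Fin n} where

  complement-antiadjacent⇒adjacent : Antiadjacent (complement T) u v → Adjacent T u v
  complement-antiadjacent⇒adjacent a with θ T u v
  ... | zer = inj₁ refl
  ... | pos = inj₂ refl
  complement-antiadjacent⇒adjacent (inj₁ ()) | neg
  complement-antiadjacent⇒adjacent (inj₂ ()) | neg

  complement-adjacent⇒¬stronglyAdjacent : Adjacent (complement T) u v → ¬ StronglyAdjacent T u v
  complement-adjacent⇒¬stronglyAdjacent a θ≡pos rewrite θ≡pos with a
  ... | inj₁ ()
  ... | inj₂ ()

  complement-antiadjacent⇒¬stronglyAntiadjacent :
    Antiadjacent (complement T) u v → ¬ StronglyAntiadjacent T u v
  complement-antiadjacent⇒¬stronglyAntiadjacent a θ≡neg rewrite θ≡neg with a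
  ... | inj₁ ()
  ... | inj₂ ()

adjacent-sym : ∀ {n} (T : Trigraph n) {u v} → Adjacent T u v → Adjacent T v u
adjacent-sym T {u} {v} (inj₁ e) = inj₁ (trans (Trigraph.sym T v u) e)
adjacent-sym T {u} {v} (inj₂ e) = inj₂ (trans (Trigraph.sym T v u) e)

module _ {n : ℕ} where

  triple : Fin n → Fin n → Fin n → Subset n
  triple a b c = ⁅ a ⁆ ∪ ⁅ b ⁆ ∪ ⁅ c ⁆

  ∈-triple⁻ : ∀ {x} a b c → x ∈ₛ triple a b c → x ≡ a ⊎ x ≡ b ⊎ x ≡ c
  ∈-triple⁻ a b c x∈ with x∈p∪q⁻ ⁅ a ⁆ (⁅ b ⁆ ∪ ⁅ c ⁆) x∈
  ... | inj₁ x∈a = inj₁ (x∈⁅y⁆⇒x≡y a x∈a)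
  ... | inj₂ x∈bc with x∈p∪q⁻ ⁅ b ⁆ ⁅ c ⁆ x∈bc
  ...   | inj₁ x∈b = inj₂ (inj₁ (x∈⁅y⁆⇒x≡y b x∈b))
  ...   | inj₂ x∈c = inj₂ (inj₂ (x∈⁅y⁆⇒x≡y c x∈c))

  3≤∣triple∣ : ∀ {a b c} → a ≢ b → a ≢ c → b ≢ c → 3 ≤ ∣ triple a b c ∣
  3≤∣triple∣ {a} {b} {c} a≢b a≢c b≢c = ≤-trans (s≤s 2≤∣bc∣) ∣bc∣<∣abc∣
    where
    2≤∣bc∣ : 2 ≤ ∣ ⁅ b ⁆ ∪ ⁅ c ⁆ ∣
    2≤∣bc∣ = subst (_< ∣ ⁅ b ⁆ ∪ ⁅ c ⁆ ∣) (∣⁅x⁆∣≡1 c)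
      (p⊂q⇒∣p∣<∣q∣ (q⊆p∪q ⁅ b ⁆ ⁅ c ⁆ , b , x∈p∪q⁺ (inj₁ (x∈⁅x⁆ b)) , x≢y⇒x∉⁅y⁆ b≢c))

    a∉bc : a ∉ ⁅ b ⁆ ∪ ⁅ c ⁆
    a∉bc a∈ with x∈p∪q⁻ ⁅ b ⁆ ⁅ c ⁆ a∈
    ... | inj₁ a∈b = a≢b (x∈⁅y⁆⇒x≡y b a∈b)
    ... | inj₂ a∈c = a≢c (x∈⁅y⁆⇒x≡y c a∈c)

    ∣bc∣<∣abc∣ : ∣ ⁅ b ⁆ ∪ ⁅ c ⁆ ∣ < ∣ triple a b c ∣
    ∣bc∣<∣abc∣ = p⊂q⇒∣p∣<∣q∣
      (q⊆p∪q ⁅ a ⁆ (⁅ b ⁆ ∪ ⁅ c ⁆) , a , x∈p∪q⁺ (inj₁ (x∈⁅x⁆ a)) , a∉bc)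

  triple-isClique : ∀ (T : Trigraph n) {a b c} →
    Adjacent T a b → Adjacent T a c → Adjacent T b c → IsClique T (triple a b c)
  triple-isClique T {a} {b} {c} ab ac bc x y x∈ y∈ x≢y
    with ∈-triple⁻ a b c x∈ | ∈-triple⁻ a b c y∈
  ... | inj₁ refl        | inj₁ refl        = ⊥-elim (x≢y refl)
  ... | inj₁ refl        | inj₂ (inj₁ refl) = ab
  ... | inj₁ refl        | inj₂ (inj₂ refl) = ac
  ... | inj₂ (inj₁ refl) | inj₁ refl        = adjacent-sym T ab
  ... | inj₂ (inj₁ refl) | inj₂ (inj₁ refl) = ⊥-elim (x≢y refl)
  ... | inj₂ (inj₁ refl) | inj₂ (inj₂ refl) = bc
  ... | inj₂ (inj₂ refl) | inj₁ refl        = adjacent-sym T ac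
  ... | inj₂ (inj₂ refl) | inj₂ (inj₁ refl) = adjacent-sym T bc
  ... | inj₂ (inj₂ refl) | inj₂ (inj₂ refl) = ⊥-elim (x≢y refl)

  LargeCliquesStrong : Trigraph n → Set
  LargeCliquesStrong T = ∀ (S : Subset n) → IsClique T S → 3 ≤ ∣ S ∣ → IsStrongClique T S

  triangle⇒stronglyAdjacent : ∀ (T : Trigraph n) → LargeCliquesStrong T → ∀ {a b c} →
    a ≢ b → a ≢ c → b ≢ c →
    Adjacent T a b → Adjacent T a c → Adjacent T b c → StronglyAdjacent T a b
  triangle⇒stronglyAdjacent T strong {a} {b} {c} a≢b a≢c b≢c ab ac bc =
    strong (triple a b c) (triple-isClique T ab ac bc) (3≤∣triple∣ a≢b a≢c b≢c)
      a b (x∈p∪q⁺ (inj₁ (x∈⁅x⁆ a))) (x∈p∪q⁺ (inj₂ (x∈p∪q⁺ (inj₁ (x∈⁅x⁆ b))))) a≢b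

-- A pair in A × B is an edge of a bipartite graph with sides A and B; Meets says two edges share
-- an end.
module _ {A B : Set} where

  Meets : A × B → A × B → Set
  Meets (x , y) (x′ , y′) = x ≡ x′ ⊎ y ≡ y′

  ≡⇒Meets : ∀ {e f : A × B} → e ≡ f → Meets e f
  ≡⇒Meets refl = inj₁ refl

  meets-disjoint-pair⇒cross : ∀ {e f g : A × B} → ¬ Meets e f → Meets e g → Meets f g →
    g ≡ (proj₁ e , proj₂ f) ⊎ g ≡ (proj₁ f , proj₂ e)
  meets-disjoint-pair⇒cross e∦f (inj₁ refl) (inj₁ refl) = ⊥-elim (e∦f (inj₁ refl))
  meets-disjoint-pair⇒cross e∦f (inj₁ refl) (inj₂ refl) = inj₁ refl
  meets-disjoint-pair⇒cross e∦f (inj₂ refl) (inj₁ refl) = inj₂ refl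
  meets-disjoint-pair⇒cross e∦f (inj₂ refl) (inj₂ refl) = ⊥-elim (e∦f (inj₂ refl))

  alternating-cross-edges : ∀ (e f g₁ g₂ g₃ : A × B) → ¬ Meets e f →
    Meets e g₁ → Meets f g₁ → Meets e g₂ → Meets f g₂ → Meets e g₃ → Meets f g₃ →
    ¬ Meets g₁ g₂ → ¬ Meets g₂ g₃ → g₁ ≡ g₃
  alternating-cross-edges _ _ _ _ _ e∦f eg₁ fg₁ eg₂ fg₂ eg₃ fg₃ g₁∦g₂ g₂∦g₃
    with meets-disjoint-pair⇒cross e∦f eg₁ fg₁
       | meets-disjoint-pair⇒cross e∦f eg₂ fg₂
       | meets-disjoint-pair⇒cross e∦f eg₃ fg₃
  ... | inj₁ p | inj₁ q | _      = ⊥-elim (g₁∦g₂ (≡⇒Meets (trans p (≡-sym q))))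
  ... | inj₂ p | inj₂ q | _      = ⊥-elim (g₁∦g₂ (≡⇒Meets (trans p (≡-sym q))))
  ... | _      | inj₁ q | inj₁ r = ⊥-elim (g₂∦g₃ (≡⇒Meets (trans q (≡-sym r))))
  ... | _      | inj₂ q | inj₂ r = ⊥-elim (g₂∦g₃ (≡⇒Meets (trans q (≡-sym r))))
  ... | inj₁ p | inj₂ _ | inj₁ r = trans p (≡-sym r)
  ... | inj₂ p | inj₁ _ | inj₂ r = trans p (≡-sym r)

module _ {n} {T : Trigraph n} {k} (P : Path T k) where
  open Path P

  prefix : ∀ {m} → m ≤ k → Path T m
  prefix m≤k = record
    { vert     = λ i → vert (ι i)
    ; distinct = λ i j e → inject≤-injective _ _ i j (distinct (ι i) (ι j) e)
    ; adj      = λ i j j≡1+i → adj (ι i) (ι j) (reindex (λ a b → b ≡ suc a) j j≡1+i)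
    ; antiadj  = λ i j far → antiadj (ι i) (ι j) (reindex (λ a b → 2 + a ≤ b) j far)
    }
    where
    ι : _ → Fin (suc k)
    ι i = inject≤ i (s≤s m≤k)

    reindex : ∀ (R : ℕ → ℕ → Set) {i} j → R (toℕ i) (toℕ j) → R (toℕ (ι i)) (toℕ (ι j))
    reindex R {i} j r rewrite toℕ-inject≤ i (s≤s m≤k) | toℕ-inject≤ j (s≤s m≤k) = r

  vert-≢ : ∀ {i j} → i ≢ j → vert i ≢ vert j
  vert-≢ i≢j e = i≢j (distinct _ _ e)

  far⇒vert-≢ : ∀ {i j} → 2 + toℕ i ≤ toℕ j → vert i ≢ vert j
  far⇒vert-≢ far = vert-≢ λ { refl → 1+n≰n (m+n≤o⇒n≤o 1 far) }

  consecutive⇒vert-≢ : ∀ {i j} → toℕ j ≡ suc (toℕ i) → vert i ≢ vert j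
  consecutive⇒vert-≢ j≡1+i = vert-≢ λ { refl → 1+n≢n (≡-sym j≡1+i) }

two-of-three-equal : ∀ (a b c : Bool) → a ≡ b ⊎ a ≡ c ⊎ b ≡ c
two-of-three-equal false false _     = inj₁ refl
two-of-three-equal true  true  _     = inj₁ refl
two-of-three-equal false true  false = inj₂ (inj₁ refl)
two-of-three-equal true  false true  = inj₂ (inj₁ refl)
two-of-three-equal false true  true  = inj₂ (inj₂ refl)
two-of-three-equal true  false false = inj₂ (inj₂ refl)

module _ {n} {T : Trigraph n} where

  bipartite⇒¬complement-path-4 : IsBipartite T → ¬ Path (complement T) 4
  bipartite⇒¬complement-path-4 (side , same-side⇒anti) P =
    [ opposite-sides (# 0) (# 2) , [ opposite-sides (# 0) (# 4) , opposite-sides (# 2) (# 4) ]′ ]′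
      (two-of-three-equal (side (vert (# 0))) (side (vert (# 2))) (side (vert (# 4))))
    where
    open Path P
    opposite-sides : ∀ i j {far : True (2 + toℕ i ≤? toℕ j)} → side (vert i) ≢ side (vert j)
    opposite-sides i j {far} same = complement-antiadjacent⇒¬stronglyAntiadjacent T
      (antiadj i j (toWitness far)) (same-side⇒anti _ _ (far⇒vert-≢ P (toWitness far)) same)

  lineTrigraph⇒¬complement-path-5 : IsLineTrigraph T → ¬ Path (complement T) 5
  lineTrigraph⇒¬complement-path-5 ((p , q , e , e-injective , adjacent⇔meets) , strong) P =
    vert-≢ P {# 3} {# 5} (λ ()) (e-injective _ _
      (alternating-cross-edges (ε (# 0)) (ε (# 1)) (ε (# 3)) (ε (# 4)) (ε (# 5)) e₀∦e₁
        (meets (# 0) (# 3)) (meets (# 1) (# 3))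
        (meets (# 0) (# 4)) (meets (# 1) (# 4))
        (meets (# 0) (# 5)) (meets (# 1) (# 5))
        e₃∦e₄ e₄∦e₅))
    where
    open Path P

    ε : Fin 6 → Fin p × Fin q
    ε i = e (vert i)

    adjacent : ∀ i j {far : True (2 + toℕ i ≤? toℕ j)} → Adjacent T (vert i) (vert j)
    adjacent i j {far} = complement-antiadjacent⇒adjacent T (antiadj i j (toWitness far))

    meets : ∀ i j {far : True (2 + toℕ i ≤? toℕ j)} → Meets (ε i) (ε j)
    meets i j {far} =
      Equivalence.to (adjacent⇔meets _ _ (far⇒vert-≢ P (toWitness far))) (adjacent i j {far})

    apart : ∀ i j c → toℕ j ≡ suc (toℕ i) → i ≢ c → j ≢ c →
      Adjacent T (vert i) (vert c) → Adjacent T (vert j) (vert c) → ¬ Meets (ε i) (ε j)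
    apart i j c j≡1+i i≢c j≢c ic jc ij-meet =
      complement-adjacent⇒¬stronglyAdjacent T (adj i j j≡1+i)
        (triangle⇒stronglyAdjacent T strong
          (consecutive⇒vert-≢ P j≡1+i) (vert-≢ P i≢c) (vert-≢ P j≢c)
          (Equivalence.from (adjacent⇔meets _ _ (consecutive⇒vert-≢ P j≡1+i)) ij-meet) ic jc)

    e₀∦e₁ : ¬ Meets (ε (# 0)) (ε (# 1))
    e₀∦e₁ = apart (# 0) (# 1) (# 3) refl (λ ()) (λ ())
      (adjacent (# 0) (# 3)) (adjacent (# 1) (# 3))

    e₃∦e₄ : ¬ Meets (ε (# 3)) (ε (# 4))
    e₃∦e₄ = apart (# 3) (# 4) (# 1) refl (λ ()) (λ ())
      (adjacent-sym T (adjacent (# 1) (# 3))) (adjacent-sym T (adjacent (# 1) (# 4)))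

    e₄∦e₅ : ¬ Meets (ε (# 4)) (ε (# 5))
    e₄∦e₅ = apart (# 4) (# 5) (# 1) refl (λ ()) (λ ())
      (adjacent-sym T (adjacent (# 1) (# 4))) (adjacent-sym T (adjacent (# 1) (# 5)))

odd⇒≤3⊎5≤ : ∀ {k} → OddNat k → k ≤ 3 ⊎ 5 ≤ k
odd⇒≤3⊎5≤ (zero , refl)        = inj₁ (s≤s z≤n)
odd⇒≤3⊎5≤ (suc zero , refl)    = inj₁ ≤-refl
odd⇒≤3⊎5≤ (suc (suc m) , refl) = inj₂ (s≤s (s≤s (s≤s (≤-trans (s≤s (s≤s z≤n)) (m≤n+m _ m)))))

bipartite-or-line⇒¬complement-path-5 : ∀ {n} {T : Trigraph n} →
  IsBipartite T ⊎ IsLineTrigraph T → ¬ Path (complement T) 5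
bipartite-or-line⇒¬complement-path-5 (inj₁ bipartite) P =
  bipartite⇒¬complement-path-4 bipartite (prefix P (s≤s (s≤s (s≤s (s≤s z≤n)))))
bipartite-or-line⇒¬complement-path-5 (inj₂ line) P = lineTrigraph⇒¬complement-path-5 line P

proposition4p7 : ∀ {n} (T₀ : Trigraph n) → IsBipartite T₀ ⊎ IsLineTrigraph T₀ →
    ∀ (k : ℕ) → Path (complement T₀) k → OddNat k → k ≤ 3
proposition4p7 T₀ bipartite-or-line k P odd with odd⇒≤3⊎5≤ odd
... | inj₁ k≤3 = k≤3
... | inj₂ 5≤k = ⊥-elim (bipartite-or-line⇒¬complement-path-5 bipartite-or-line (prefix P 5≤k))
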